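{- Let $xy$ be an edge of a graph $G$ and let $B(x,y)=N_G(x)\cap N_G(y)$. Then $xy$ is an avoidable edge in $G$ if and only if $xy$ is a protected edge in $G-B(x,y)$.
   Context: All graphs are finite, simple and undirected. A $P_4$ is an induced path on four vertices; the middle edge of a $P_4=a,b,c,d$ is $bc$. An edge $uv$ is simplicial if there is no $P_4$ having $uv$ as middle edge, and avoidable if either it is simplicial or every $P_4$ with middle edge $uv$ is contained in an induced cycle. For $S\subseteq V(H)$, an $S$-excluded path is a path none of whose internal vertices belongs to $S$ (an edge is $S$-excluded for every $S$; a vertex is joined to itself by the trivial path). An edge $xy$ of a graph $H$ is protected (in $H$) if there is an $(N_H[x]\cup N_H[y])$-excluded path in $H$ between every vertex of $N_H(x)$ and every vertex of $N_H(y)$. -}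

module Defs where

open import Data.Nat using (ℕ; zero; suc; _+_; _%_)
open import Data.Fin using (Fin; zero; suc; toℕ; fromℕ; inject₁)
open import Data.Bool using (Bool; true; false)
open import Data.Product using (Σ; ∃; _×_; _,_; proj₁)
open import Data.Sum using (_⊎_)
open import Data.Empty using (⊥)
open import Relation.Nullary using (¬_)
open import Relation.Binary.PropositionalEquality using (_≡_; _≢_)
open import Function.Bundles using (_↔_)
open import Function.Definitions using (Injective)

record Graph : Set₁ where
  field
    V     : Set
    adj   : V → V → Bool
    sym   : ∀ u v → adj u v ≡ adj v u
    irrefl : ∀ v → adj v v ≡ false

open Graph public

Adj : (G : Graph) → V G → V G → Set
Adj G u v = adj G u v ≡ true

Finite : Graph → Set
Finite G = Σ ℕ λ n → V G ↔ Fin n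

N : (G : Graph) → V G → V G → Set
N G x v = Adj G x v

N[_] : (G : Graph) → V G → V G → Set
N[ G ] x v = (v ≡ x) ⊎ Adj G x v

IsP4 : (G : Graph) → V G → V G → V G → V G → Set
IsP4 G a b c d =
  Adj G a b × Adj G b c × Adj G c d ×
  ¬ Adj G a c × ¬ Adj G b d × ¬ Adj G a d ×
  a ≢ b × a ≢ c × a ≢ d × b ≢ c × b ≢ d × c ≢ d

P4WithMiddle : (G : Graph) → V G → V G → V G → V G → V G → V G → Set
P4WithMiddle G x y a b c d =
  IsP4 G a b c d × ((b ≡ x × c ≡ y) ⊎ (b ≡ y × c ≡ x))

Simplicial : (G : Graph) → V G → V G → Set
Simplicial G x y = ∀ a b c d → ¬ P4WithMiddle G x y a b c d

-- induced cycle of length k + 3, given by an injective cyclic sequence f of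
-- vertices such that f i and f j are adjacent iff i, j are cyclically consecutive
CycAdjIdx : (k : ℕ) → Fin (suc (suc (suc k))) → Fin (suc (suc (suc k))) → Set
CycAdjIdx k i j =
  (toℕ j ≡ suc (toℕ i) % suc (suc (suc k))) ⊎
  (toℕ i ≡ suc (toℕ j) % suc (suc (suc k)))

record InducedCycle (G : Graph) : Set where
  field
    k    : ℕ
    f    : Fin (suc (suc (suc k))) → V G
    inj  : Injective _≡_ _≡_ f
    adjI : ∀ i j → (Adj G (f i) (f j) → CycAdjIdx k i j) × (CycAdjIdx k i j → Adj G (f i) (f j))

OnCycle : (G : Graph) → InducedCycle G → V G → Set
OnCycle G C v = Σ (Fin (suc (suc (suc (InducedCycle.k C))))) λ i → InducedCycle.f C i ≡ v

-- the P4 a,b,c,d is contained in an induced cycle (as an induced subgraph,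
-- i.e. all four vertices lie on the induced cycle)
InInducedCycle : (G : Graph) → V G → V G → V G → V G → Set
InInducedCycle G a b c d =
  Σ (InducedCycle G) λ C → OnCycle G C a × OnCycle G C b × OnCycle G C c × OnCycle G C d

Avoidable : (G : Graph) → V G → V G → Set
Avoidable G x y =
  Simplicial G x y ⊎
  (∀ a b c d → P4WithMiddle G x y a b c d → InInducedCycle G a b c d)

record ExcludedPath (G : Graph) (S : V G → Set) (u v : V G) : Set where
  field
    k        : ℕ
    f        : Fin (suc k) → V G
    inj      : Injective _≡_ _≡_ f
    start    : f zero ≡ u
    end      : f (fromℕ k) ≡ v
    steps    : ∀ (i : Fin k) → Adj G (f (inject₁ i)) (f (suc i))
    internal : ∀ (i : Fin (suc k)) → i ≢ zero → i ≢ fromℕ k → ¬ S (f i)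

Protected : (H : Graph) → V H → V H → Set
Protected H x y =
  ∀ u v → N H x u → N H y v →
  ExcludedPath H (λ w → N[ H ] x w ⊎ N[ H ] y w) u v

B : (G : Graph) → V G → V G → V G → Set
B G x y v = N G x v × N G y v

_∖_ : (G : Graph) → (V G → Set) → Graph
G ∖ S = record
  { V      = Σ (V G) (λ v → ¬ S v)
  ; adj    = λ u v → adj G (proj₁ u) (proj₁ v)
  ; sym    = λ u v → sym G (proj₁ u) (proj₁ v)
  ; irrefl = λ v → irrefl G (proj₁ v)
  }

private
  t≢f : true ≡ false → ⊥
  t≢f ()

  open import Relation.Binary.PropositionalEquality using (trans)
    renaming (sym to ≡sym)

  notInB₁ : (G : Graph) (x y : V G) → ¬ B G x y x
  notInB₁ G x y (xx , _) = t≢f (trans (≡sym xx) (irrefl G x))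

  notInB₂ : (G : Graph) (x y : V G) → ¬ B G x y y
  notInB₂ G x y (_ , yy) = t≢f (trans (≡sym yy) (irrefl G y))

G-B : (G : Graph) → V G → V G → Graph
G-B G x y = G ∖ B G x y

xᴮ : (G : Graph) (x y : V G) → V (G-B G x y)
xᴮ G x y = x , notInB₁ G x y

yᴮ : (G : Graph) (x y : V G) → V (G-B G x y)
yᴮ G x y = y , notInB₂ G x y

-- If xy is avoidable and u ∈ N(x), v ∈ N(y) lie outside B(x,y), then either
-- u = y, v = x or uv is an edge, or u,x,y,v is a P4 with middle edge xy.  In
-- the last case the P4 lies on an induced cycle, and the rest of that cycle is
-- a u–v path avoiding N[x] ∪ N[y], hence also B(x,y) ⊆ N(x).  Conversely, for
-- a P4 a,x,y,d the protecting a–d path, shortened greedily to a chordless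
-- path, closes up with y and x to an induced cycle through a, x, y, d.
module Submission where

open import Defs hiding (sym)
open import Data.Bool using (true; false)
open import Data.Bool.Properties using () renaming (_≟_ to _≟ᵇ_)
open import Data.Empty using (⊥-elim)
open import Data.Fin using (Fin; toℕ; fromℕ; fromℕ<; inject₁)
open import Data.Fin.Properties using (toℕ-injective; toℕ<n; toℕ≤pred[n]; toℕ-fromℕ; toℕ-fromℕ<; toℕ-inject₁; inj⇒≟)
open import Data.Nat using (ℕ; NonZero; zero; suc; _+_; _*_; _∸_; _≤_; _<_; _%_; z≤n; s≤s; s≤s⁻¹; z<s; _≟_; _≤?_; _<?_)
open import Data.Nat.Properties
open import Data.Nat.DivMod using (_mod_; m<n⇒m%n≡m; n%n≡0; m≤n⇒m%n≡m; [m+n]%n≡m%n; [m+kn]%n≡m%n; %-distribˡ-+; m%n%n≡m%n; m%n<n)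
open import Data.Product using (Σ; _×_; _,_; proj₁; proj₂)
open import Data.Sum using (_⊎_; inj₁; inj₂; swap)
open import Function.Bundles using (_⇔_; mk⇔)
open import Function.Properties.Inverse using (↔⇒↣)
open import Relation.Binary.Definitions using (DecidableEquality; tri<; tri≈; tri>)
open import Relation.Nullary using (¬_; Dec; yes; no)
open import Relation.Binary.PropositionalEquality

%-cancelʳ-+ : ∀ a b s n .{{_ : NonZero n}} → (a + s) % n ≡ (b + s) % n → a % n ≡ b % n
%-cancelʳ-+ a b s n@(suc m) eq = begin
  a % n                          ≡⟨ shift a ⟩
  ((a + s) % n + s * m % n) % n  ≡⟨ cong (λ r → (r + s * m % n) % n) eq ⟩
  ((b + s) % n + s * m % n) % n  ≡⟨ shift b ⟨
  b % n                          ∎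
  where
  open ≡-Reasoning
  shift : ∀ c → c % n ≡ ((c + s) % n + s * m % n) % n
  shift c = begin
    c % n                          ≡⟨ [m+kn]%n≡m%n c s n ⟨
    (c + s * n) % n                ≡⟨ cong (λ r → (c + r) % n) (*-suc s m) ⟩
    (c + (s + s * m)) % n          ≡⟨ cong (_% n) (+-assoc c s (s * m)) ⟨
    (c + s + s * m) % n            ≡⟨ %-distribˡ-+ (c + s) (s * m) n ⟩
    ((c + s) % n + s * m % n) % n  ∎

%-suc-injective : ∀ a b n .{{_ : NonZero n}} → suc a % n ≡ suc b % n → a % n ≡ b % n
%-suc-injective a b n eq =
  %-cancelʳ-+ a b 1 n (trans (cong (_% n) (+-comm a 1)) (trans eq (cong (_% n) (+-comm 1 b))))

[1+m%n]%n≡[1+m]%n : ∀ m n .{{_ : NonZero n}} → suc (m % n) % n ≡ suc m % n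
[1+m%n]%n≡[1+m]%n m n = begin
  (1 + m % n) % n          ≡⟨ %-distribˡ-+ 1 (m % n) n ⟩
  (1 % n + m % n % n) % n  ≡⟨ cong (λ r → (1 % n + r) % n) (m%n%n≡m%n m n) ⟩
  (1 % n + m % n) % n      ≡⟨ %-distribˡ-+ 1 m n ⟨
  (1 + m) % n              ∎
  where open ≡-Reasoning

toℕ-mod : ∀ m n .{{_ : NonZero n}} → toℕ (m mod n) ≡ m % n
toℕ-mod m n = toℕ-fromℕ< (m%n<n m n)

toℕ-mod-≤ : ∀ {m n} → m ≤ n → toℕ (m mod suc n) ≡ m
toℕ-mod-≤ {m} {n} m≤n = trans (toℕ-mod m (suc n)) (m≤n⇒m%n≡m m≤n)

module AdjProperties (G : Graph) where

  Adj-sym : ∀ {u v} → Adj G u v → Adj G v u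
  Adj-sym {u} {v} uv = trans (Graph.sym G v u) uv

  Adj⇒≢ : ∀ {u v} → Adj G u v → u ≢ v
  Adj⇒≢ {u} uu refl with trans (sym uu) (irrefl G u)
  ... | ()

  Adj? : ∀ u v → Dec (Adj G u v)
  Adj? u v = adj G u v ≟ᵇ true

  finite⇒≟ : Finite G → DecidableEquality (V G)
  finite⇒≟ (_ , V↔Fin) = inj⇒≟ (↔⇒↣ V↔Fin)

Near : (G : Graph) → V G → V G → V G → Set
Near G x y w = N[ G ] x w ⊎ N[ G ] y w

-- Vertices are indexed by ℕ rather than Fin (suc len) so that all index
-- arithmetic stays in ℕ; the values of at beyond len are irrelevant.
record Walk (G : Graph) (S : V G → Set) (u v : V G) : Set where
  field
    len    : ℕ
    at     : ℕ → V G
    start  : at 0 ≡ u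
    end    : at len ≡ v
    step   : ∀ t → t < len → Adj G (at t) (at (suc t))
    avoids : ∀ t → 0 < t → t < len → ¬ S (at t)

open Walk

module _ {G : Graph} {S : V G → Set} {u v : V G} where

  IsPath : Walk G S u v → Set
  IsPath p = ∀ s t → s ≤ len p → t ≤ len p → at p s ≡ at p t → s ≡ t

  Chordless : Walk G S u v → Set
  Chordless p = ∀ s t → suc s < t → t ≤ len p → ¬ Adj G (at p s) (at p t)

Path : (G : Graph) → (V G → Set) → V G → V G → Set
Path G S u v = Σ (Walk G S u v) IsPath

module _ {G : Graph} {S : V G → Set} where
  open AdjProperties G

  chordless-no-repeat : ∀ {u v} → u ≢ v → (p : Walk G S u v) → Chordless p →
                        ∀ {s t} → s < t → t ≤ len p → at p s ≢ at p t
  chordless-no-repeat u≢v p chordless {s} {t} s<t t≤ eq with m≤n⇒m<n∨m≡n s<t | m≤n⇒m<n∨m≡n t≤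
  ... | inj₂ refl | _ = Adj⇒≢ (step p s (<-≤-trans (n<1+n s) t≤)) eq
  ... | inj₁ s+1<t | inj₁ t<len =
    chordless s (suc t) (<-trans s+1<t (n<1+n t)) t<len (subst (λ w → Adj G w (at p (suc t))) (sym eq) (step p t t<len))
  ... | inj₁ s+1<t | inj₂ refl with s
  ...   | zero = u≢v (trans (sym (start p)) (trans eq (end p)))
  ...   | suc s′ = chordless s′ t (<-trans (n<1+n _) s+1<t) ≤-refl
                     (subst (Adj G (at p s′)) eq (step p s′ (<-trans (n<1+n _) s<t)))

  chordless⇒isPath : ∀ {u v} → u ≢ v → (p : Walk G S u v) → Chordless p → IsPath p
  chordless⇒isPath u≢v p chordless s t s≤ t≤ eq with <-cmp s t
  ... | tri< s<t _ _ = ⊥-elim (chordless-no-repeat u≢v p chordless s<t t≤ eq)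
  ... | tri≈ _ s≡t _ = s≡t
  ... | tri> _ _ t<s = ⊥-elim (chordless-no-repeat u≢v p chordless t<s s≤ (sym eq))

  chordless-adj : ∀ {u v} (p : Walk G S u v) → Chordless p → ∀ {s t} → s ≤ len p → t ≤ len p →
                  Adj G (at p s) (at p t) → t ≡ suc s ⊎ s ≡ suc t
  chordless-adj p chordless {s} {t} s≤ t≤ st with <-cmp s t
  ... | tri≈ _ refl _ = ⊥-elim (Adj⇒≢ st refl)
  ... | tri< s<t _ _ with m≤n⇒m<n∨m≡n s<t
  ...   | inj₂ s+1≡t = inj₁ (sym s+1≡t)
  ...   | inj₁ s+1<t = ⊥-elim (chordless s t s+1<t t≤ st)
  chordless-adj p chordless {s} {t} s≤ t≤ st | tri> _ _ t<s with m≤n⇒m<n∨m≡n t<s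
  ...   | inj₂ t+1≡s = inj₂ (sym t+1≡s)
  ...   | inj₁ t+1<s = ⊥-elim (chordless t s t+1<s s≤ (Adj-sym st))

  edge : ∀ {u v} → Adj G u v → Path G S u v
  edge {u} {v} uv = p , chordless⇒isPath (Adj⇒≢ uv) p chordless
    where
    p : Walk G S u v
    p = record
      { len = 1 ; at = λ { zero → u ; (suc _) → v } ; start = refl ; end = refl
      ; step = λ { zero _ → uv ; (suc _) (s≤s ()) } ; avoids = λ { (suc t) _ (s≤s ()) } }
    chordless : Chordless p
    chordless s (suc zero) (s≤s ()) _
    chordless s (suc (suc t)) _ (s≤s ())

  weaken : ∀ {T : V G → Set} {u v} → (∀ w → T w → S w) → Path G S u v → Path G T u v
  weaken {T} {u} {v} T⊆S (p , path) = q , path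
    where
    q : Walk G T u v
    q = record { len = len p ; at = at p ; start = start p ; end = end p ; step = step p
               ; avoids = λ t 0<t t< z → avoids p t 0<t t< (T⊆S _ z) }

  reverse : ∀ {u v} → Path G S u v → Path G S v u
  reverse {u} {v} (p , path) = q , λ s t s≤ t≤ eq →
    ∸-cancelˡ-≡ s≤ t≤ (path _ _ (m∸n≤m (len p) s) (m∸n≤m (len p) t) eq)
    where
    n∸t≡1+n∸[1+t] : ∀ {t} → t < len p → len p ∸ t ≡ suc (len p ∸ suc t)
    n∸t≡1+n∸[1+t] t<len = +-∸-assoc 1 t<len
    q : Walk G S v u
    q = record
      { len = len p ; at = λ t → at p (len p ∸ t)
      ; start = end p
      ; end = subst (λ t → at p t ≡ u) (sym (n∸n≡0 (len p))) (start p)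
      ; step = λ t t< → subst (λ r → Adj G (at p r) (at p (len p ∸ suc t))) (sym (n∸t≡1+n∸[1+t] t<))
          (Adj-sym (step p _ (subst (_≤ len p) (n∸t≡1+n∸[1+t] t<) (m∸n≤m (len p) t))))
      ; avoids = λ t 0<t t< → avoids p _ (m<n⇒0<n∸m t<) (∸-monoʳ-< 0<t (<⇒≤ t<)) }

  toExcludedPath : ∀ {u v} → Path G S u v → ExcludedPath G S u v
  toExcludedPath (p , path) = record
    { k = len p ; f = λ i → at p (toℕ i)
    ; inj = λ {i} {j} eq → toℕ-injective (path _ _ (toℕ≤pred[n] i) (toℕ≤pred[n] j) eq)
    ; start = start p
    ; end = trans (cong (at p) (toℕ-fromℕ (len p))) (end p)
    ; steps = λ i → subst (λ t → Adj G (at p t) (at p (suc (toℕ i)))) (sym (toℕ-inject₁ i))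
                          (step p (toℕ i) (toℕ<n i))
    ; internal = λ i i≢0 i≢len → avoids p (toℕ i)
        (n≢0⇒n>0 (λ i≡0 → i≢0 (toℕ-injective i≡0)))
        (≤∧≢⇒< (toℕ≤pred[n] i) λ i≡len → i≢len (toℕ-injective (trans i≡len (sym (toℕ-fromℕ (len p)))))) }

  fromExcludedPath : ∀ {u v} → ExcludedPath G S u v → Walk G S u v
  fromExcludedPath q = record
    { len = K ; at = λ t → f (t mod suc K)
    ; start = ExcludedPath.start q
    ; end = trans (cong f (toℕ-injective (trans (toℕ-mod-≤ ≤-refl) (sym (toℕ-fromℕ K))))) (ExcludedPath.end q)
    ; step = λ t t<K → subst₂ (λ i j → Adj G (f i) (f j))
        (toℕ-injective (trans (toℕ-inject₁ _) (trans (toℕ-fromℕ< t<K) (sym (toℕ-mod-≤ (<⇒≤ t<K))))))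
        (toℕ-injective (trans (cong suc (toℕ-fromℕ< t<K)) (sym (toℕ-mod-≤ t<K))))
        (ExcludedPath.steps q (fromℕ< t<K))
    ; avoids = λ t 0<t t<K → ExcludedPath.internal q (t mod suc K)
        (λ t≡0 → <⇒≢ 0<t (sym (trans (sym (toℕ-mod-≤ (<⇒≤ t<K))) (cong toℕ t≡0))))
        (λ t≡K → <⇒≢ t<K (trans (sym (toℕ-mod-≤ (<⇒≤ t<K))) (trans (cong toℕ t≡K) (toℕ-fromℕ K)))) }
    where
    K : ℕ
    K = ExcludedPath.k q
    f : Fin (suc K) → V G
    f = ExcludedPath.f q

-- The greedy shortcut always jumps to the last vertex of the walk adjacent to
-- the current one; the visited indices increase, and two visited vertices that
-- are not consecutive cannot be adjacent, as that would have been a longer jump.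
module Shortcut {G : Graph} {S : V G → Set} {u v : V G} (p : Walk G S u v) where
  open AdjProperties G

  last-neighbour : ℕ → ℕ → ℕ
  last-neighbour s zero = zero
  last-neighbour s (suc t) with adj G (at p s) (at p (suc t))
  ... | true = suc t
  ... | false = last-neighbour s t

  last-neighbour-≤ : ∀ s t → last-neighbour s t ≤ t
  last-neighbour-≤ s zero = z≤n
  last-neighbour-≤ s (suc t) with adj G (at p s) (at p (suc t))
  ... | true = ≤-refl
  ... | false = m≤n⇒m≤1+n (last-neighbour-≤ s t)

  last-neighbour-maximal : ∀ s t r → Adj G (at p s) (at p r) → r ≤ t →
                           r ≤ last-neighbour s t × Adj G (at p s) (at p (last-neighbour s t))
  last-neighbour-maximal s zero zero sr z≤n = z≤n , sr
  last-neighbour-maximal s (suc t) r sr r≤ with adj G (at p s) (at p (suc t)) in eq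
  ... | true = r≤ , eq
  ... | false with m≤n⇒m<n∨m≡n r≤
  ...   | inj₁ r<1+t = last-neighbour-maximal s t r sr (m<1+n⇒m≤n r<1+t)
  ...   | inj₂ refl with trans (sym sr) eq
  ...     | ()

  jump : ℕ → ℕ
  jump s = last-neighbour s (len p)

  jump-≤ : ∀ s → jump s ≤ len p
  jump-≤ s = last-neighbour-≤ s (len p)

  jump-> : ∀ s → s < len p → s < jump s
  jump-> s s< = proj₁ (last-neighbour-maximal s (len p) (suc s) (step p s s<) s<)

  jump-adj : ∀ s → s < len p → Adj G (at p s) (at p (jump s))
  jump-adj s s< = proj₂ (last-neighbour-maximal s (len p) (suc s) (step p s s<) s<)

  beyond-jump : ∀ s r → jump s < r → r ≤ len p → ¬ Adj G (at p s) (at p r)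
  beyond-jump s r jump<r r≤ sr = <⇒≱ jump<r (proj₁ (last-neighbour-maximal s (len p) r sr r≤))

  -- hop f s i is the index reached after i jumps from s, hops f s the number of
  -- jumps needed to reach len p; f is fuel, sufficient whenever Fuel f s holds.
  hop : ℕ → ℕ → ℕ → ℕ
  hop f s zero = s
  hop zero s (suc i) = s
  hop (suc f) s (suc i) = hop f (jump s) i

  hops : ℕ → ℕ → ℕ
  hops zero s = 0
  hops (suc f) s with s <? len p
  ... | yes _ = suc (hops f (jump s))
  ... | no _ = 0

  Fuel : ℕ → ℕ → Set
  Fuel f s = s ≤ len p × len p ∸ s ≤ f

  fuel-jump : ∀ {f s} → Fuel (suc f) s → s < len p → Fuel f (jump s)
  fuel-jump {f} {s} (_ , enough) s< =
    jump-≤ s , m<1+n⇒m≤n (<-≤-trans (∸-monoʳ-< (jump-> s s<) (jump-≤ s)) enough)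

  hop-end : ∀ f s → Fuel f s → hop f s (hops f s) ≡ len p
  hop-end zero s (s≤ , enough) = ≤-antisym s≤ (m∸n≡0⇒m≤n (n≤0⇒n≡0 enough))
  hop-end (suc f) s fuel with s <? len p
  ... | yes s< = hop-end f (jump s) (fuel-jump fuel s<)
  ... | no s≮ = ≤-antisym (proj₁ fuel) (≮⇒≥ s≮)

  hop-≤ : ∀ f s → Fuel f s → ∀ i → i ≤ hops f s → hop f s i ≤ len p
  hop-≤ f s fuel zero _ = proj₁ fuel
  hop-≤ (suc f) s fuel (suc i) i≤ with s <? len p
  ... | yes s< = hop-≤ f (jump s) (fuel-jump fuel s<) i (s≤s⁻¹ i≤)

  hop-< : ∀ f s → Fuel f s → ∀ {i j} → i < j → j ≤ hops f s → hop f s i < hop f s j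
  hop-< (suc f) s fuel {i} {suc j} i<j j≤ with s <? len p
  hop-< (suc f) s fuel {zero} {suc zero} _ _ | yes s< = jump-> s s<
  hop-< (suc f) s fuel {zero} {suc (suc j)} _ j≤ | yes s< =
    <-trans (jump-> s s<) (hop-< f (jump s) (fuel-jump fuel s<) z<s (s≤s⁻¹ j≤))
  hop-< (suc f) s fuel {suc i} {suc j} i<j j≤ | yes s< =
    hop-< f (jump s) (fuel-jump fuel s<) (s≤s⁻¹ i<j) (s≤s⁻¹ j≤)

  hop-adj : ∀ f s → Fuel f s → ∀ i → i < hops f s → Adj G (at p (hop f s i)) (at p (hop f s (suc i)))
  hop-adj (suc f) s fuel i i< with s <? len p
  hop-adj (suc f) s fuel zero _ | yes s< = jump-adj s s<
  hop-adj (suc f) s fuel (suc i) i< | yes s< = hop-adj f (jump s) (fuel-jump fuel s<) i (s≤s⁻¹ i<)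

  hop-chordless : ∀ f s → Fuel f s → ∀ i j → suc i < j → j ≤ hops f s →
                  ¬ Adj G (at p (hop f s i)) (at p (hop f s j))
  hop-chordless (suc f) s fuel i (suc j) i+1<j j≤ with s <? len p
  hop-chordless (suc f) s fuel zero (suc zero) (s≤s ()) _ | yes s<
  hop-chordless (suc f) s fuel zero (suc (suc j)) _ j≤ | yes s< =
    beyond-jump s _ (hop-< f (jump s) fuel′ z<s (s≤s⁻¹ j≤)) (hop-≤ f (jump s) fuel′ (suc j) (s≤s⁻¹ j≤))
    where fuel′ = fuel-jump fuel s<
  hop-chordless (suc f) s fuel (suc i) (suc j) i+1<j j≤ | yes s< =
    hop-chordless f (jump s) (fuel-jump fuel s<) i j (s≤s⁻¹ i+1<j) (s≤s⁻¹ j≤)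

  full-fuel : Fuel (len p) 0
  full-fuel = z≤n , ≤-refl

  shortcut : Σ (Walk G S u v) Chordless
  shortcut = q , hop-chordless (len p) 0 full-fuel
    where
    L : ℕ
    L = hops (len p) 0
    index : ℕ → ℕ
    index = hop (len p) 0
    q : Walk G S u v
    q = record
      { len = L ; at = λ i → at p (index i)
      ; start = start p
      ; end = subst (λ t → at p t ≡ v) (sym (hop-end (len p) 0 full-fuel)) (end p)
      ; step = hop-adj (len p) 0 full-fuel
      ; avoids = λ t 0<t t<L → avoids p (index t)
          (hop-< (len p) 0 full-fuel 0<t (<⇒≤ t<L))
          (subst (index t <_) (hop-end (len p) 0 full-fuel) (hop-< (len p) 0 full-fuel t<L ≤-refl)) }

open Shortcut using (shortcut)

module _ {G : Graph} {S : V G → Set} where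
  open AdjProperties G

  restrict : ∀ {T : V G → Set} {T′ : V (G ∖ S) → Set} {u v} →
             (∀ w → S w → T w) → (∀ w → T′ w → T (proj₁ w)) →
             (u∉S : ¬ S u) (v∉S : ¬ S v) → u ≢ v →
             Path G T u v → Path (G ∖ S) T′ (u , u∉S) (v , v∉S)
  restrict {T} {T′} {u} {v} S⊆T T′⊆T u∉S v∉S u≢v (p , path) = q , q-path
    where
    -- The endpoints must carry exactly the given proofs u∉S and v∉S: without
    -- function extensionality other proofs of ¬ S u need not be equal to them.
    lift : ℕ → V (G ∖ S)
    lift zero = u , u∉S
    lift (suc t) with suc t <? len p
    ... | yes t< = at p (suc t) , λ s → avoids p (suc t) z<s t< (S⊆T _ s)
    ... | no _ = v , v∉S

    lift-proj₁ : ∀ t → t ≤ len p → proj₁ (lift t) ≡ at p t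
    lift-proj₁ zero _ = sym (start p)
    lift-proj₁ (suc t) t≤ with suc t <? len p
    ... | yes _ = refl
    ... | no t≮ = trans (sym (end p)) (cong (at p) (≤-antisym (≮⇒≥ t≮) t≤))

    lift-end : ∀ t → t ≡ len p → lift t ≡ (v , v∉S)
    lift-end zero t≡len = ⊥-elim (u≢v (trans (sym (start p)) (trans (cong (at p) t≡len) (end p))))
    lift-end (suc t) t≡len with suc t <? len p
    ... | yes t< = ⊥-elim (<-irrefl t≡len t<)
    ... | no _ = refl

    q : Walk (G ∖ S) T′ (u , u∉S) (v , v∉S)
    q = record
      { len = len p ; at = lift ; start = refl ; end = lift-end (len p) refl
      ; step = λ t t< → subst₂ (Adj G) (sym (lift-proj₁ t (<⇒≤ t<))) (sym (lift-proj₁ (suc t) t<)) (step p t t<)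
      ; avoids = λ t 0<t t< z → avoids p t 0<t t< (subst T (lift-proj₁ t (<⇒≤ t<)) (T′⊆T _ z)) }

    q-path : IsPath q
    q-path s t s≤ t≤ eq = path s t s≤ t≤ (trans (sym (lift-proj₁ s s≤)) (trans (cong proj₁ eq) (lift-proj₁ t t≤)))

  unrestrict : ∀ {T : V G → Set} {T′ : V (G ∖ S) → Set} {u v} →
               (∀ w → T (proj₁ w) → T′ w) → Walk (G ∖ S) T′ u v → Walk G T (proj₁ u) (proj₁ v)
  unrestrict T⊆T′ p = record
    { len = len p ; at = λ t → proj₁ (at p t) ; start = cong proj₁ (start p) ; end = cong proj₁ (end p)
    ; step = step p ; avoids = λ t 0<t t< z → avoids p t 0<t t< (T⊆T′ _ z) }

module _ {G : Graph} {x y : V G} where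
  open AdjProperties G

  -- x and y themselves are avoided because of their neighbours on the walk.
  avoid-closed-neighbourhoods : ∀ {a d} → ¬ Adj G a y → ¬ Adj G x d →
    Walk G (λ w → Adj G x w ⊎ Adj G y w) a d → Walk G (Near G x y) a d
  avoid-closed-neighbourhoods {a} {d} ¬ay ¬xd p = record
    { len = len p ; at = at p ; start = start p ; end = end p ; step = step p ; avoids = avoids′ }
    where
    successor-not-x : ∀ t → t < len p → ¬ Adj G x (at p (suc t))
    successor-not-x t t< x-next with m≤n⇒m<n∨m≡n t<
    ... | inj₁ t+1<len = avoids p (suc t) z<s t+1<len (inj₁ x-next)
    ... | inj₂ refl = ¬xd (subst (Adj G x) (end p) x-next)

    predecessor-not-y : ∀ t → suc t < len p → ¬ Adj G y (at p t)
    predecessor-not-y zero _ y-prev = ¬ay (subst (λ w → Adj G w y) (start p) (Adj-sym y-prev))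
    predecessor-not-y (suc t) t+1< y-prev = avoids p (suc t) z<s (<-trans (n<1+n _) t+1<) (inj₂ y-prev)

    avoids′ : ∀ t → 0 < t → t < len p → ¬ Near G x y (at p t)
    avoids′ t 0<t t< (inj₁ (inj₂ xw)) = avoids p t 0<t t< (inj₁ xw)
    avoids′ t 0<t t< (inj₂ (inj₂ yw)) = avoids p t 0<t t< (inj₂ yw)
    avoids′ t _ t< (inj₁ (inj₁ w≡x)) =
      successor-not-x t t< (subst (λ w → Adj G w (at p (suc t))) w≡x (step p t t<))
    avoids′ (suc t) _ t< (inj₂ (inj₁ w≡y)) =
      predecessor-not-y t t< (Adj-sym (subst (Adj G (at p t)) w≡y (step p t (<-trans (n<1+n _) t<))))

module OnInducedCycle {G : Graph} (C : InducedCycle G) where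
  open AdjProperties G
  open InducedCycle C

  n : ℕ
  n = 3 + k

  vertex : ℕ → V G
  vertex t = f (t mod n)

  vertex-cong : ∀ s t → s % n ≡ t % n → vertex s ≡ vertex t
  vertex-cong s t eq = cong f (toℕ-injective (trans (toℕ-mod s n) (trans eq (sym (toℕ-mod t n)))))

  vertex-injective : ∀ s t → vertex s ≡ vertex t → s % n ≡ t % n
  vertex-injective s t eq = trans (sym (toℕ-mod s n)) (trans (cong toℕ (inj eq)) (toℕ-mod t n))

  vertex-toℕ : ∀ i → vertex (toℕ i) ≡ f i
  vertex-toℕ i = cong f (toℕ-injective (trans (toℕ-mod (toℕ i) n) (m<n⇒m%n≡m (toℕ<n i))))

  on-cycle : ∀ {w} → OnCycle G C w → Σ ℕ λ t → vertex t ≡ w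
  on-cycle (i , fi≡w) = toℕ i , trans (vertex-toℕ i) fi≡w

  toℕ-mod-suc : ∀ s → suc (toℕ (s mod n)) % n ≡ suc s % n
  toℕ-mod-suc s = trans (cong (λ r → suc r % n) (toℕ-mod s n)) ([1+m%n]%n≡[1+m]%n s n)

  vertex-adj : ∀ s t → Adj G (vertex s) (vertex t) → t % n ≡ suc s % n ⊎ s % n ≡ suc t % n
  vertex-adj s t st with proj₁ (adjI (s mod n) (t mod n)) st
  ... | inj₁ eq = inj₁ (trans (sym (toℕ-mod t n)) (trans eq (toℕ-mod-suc s)))
  ... | inj₂ eq = inj₂ (trans (sym (toℕ-mod s n)) (trans eq (toℕ-mod-suc t)))

  vertex-adj-suc : ∀ s → Adj G (vertex s) (vertex (suc s))
  vertex-adj-suc s = proj₂ (adjI (s mod n) (suc s mod n)) (inj₁ (trans (toℕ-mod (suc s) n) (sym (toℕ-mod-suc s))))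

  offset-residue : ∀ {a} b s → a < n → (a + s) % n ≡ (b + s) % n → a ≡ b % n
  offset-residue {a} b s a<n eq = trans (sym (m<n⇒m%n≡m a<n)) (%-cancelʳ-+ a b s n eq)

  offset-injective : ∀ {a b} s → a < n → b < n → vertex (a + s) ≡ vertex (b + s) → a ≡ b
  offset-injective {a} {b} s a<n b<n eq =
    trans (offset-residue b s a<n (vertex-injective (a + s) (b + s) eq)) (m<n⇒m%n≡m b<n)

  offset-adj : ∀ {a b} s → a < n → b < n → Adj G (vertex (a + s)) (vertex (b + s)) → b ≡ suc a % n ⊎ a ≡ suc b % n
  offset-adj {a} {b} s a<n b<n ab with vertex-adj (a + s) (b + s) ab
  ... | inj₁ eq = inj₁ (offset-residue (suc a) s b<n eq)
  ... | inj₂ eq = inj₂ (offset-residue (suc b) s a<n eq)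

  -- vertex (2 + k + s) is the predecessor of vertex s; the arc runs the long way
  -- round from the successor of vertex (1 + s) to it.
  arc : ∀ s → Path G (Near G (vertex s) (vertex (1 + s))) (vertex (2 + s)) (vertex (2 + k + s))
  arc s = p , λ a b a≤ b≤ eq →
    suc-injective (suc-injective (offset-injective s (s≤s (s≤s (s≤s a≤))) (s≤s (s≤s (s≤s b≤))) eq))
    where
    2+t<n : ∀ {t} → t < k → 2 + t < n
    2+t<n t<k = s≤s (s≤s (<⇒≤ (s≤s t<k)))
    3+t<n : ∀ {t} → t < k → 3 + t < n
    3+t<n t<k = s≤s (s≤s (s≤s t<k))
    avoids-edge : ∀ t → 0 < t → t < k → ¬ Near G (vertex s) (vertex (1 + s)) (vertex (2 + t + s))
    avoids-edge t _ t<k (inj₁ (inj₁ eq)) with offset-injective s (2+t<n t<k) z<s eq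
    ... | ()
    avoids-edge t _ t<k (inj₂ (inj₁ eq)) with offset-injective s (2+t<n t<k) (s≤s z<s) eq
    ... | ()
    avoids-edge t _ t<k (inj₁ (inj₂ adj)) with offset-adj s z<s (2+t<n t<k) adj
    ... | inj₂ 0≡3+t rewrite m<n⇒m%n≡m (3+t<n t<k) with 0≡3+t
    ...   | ()
    avoids-edge t 0<t t<k (inj₂ (inj₂ adj)) with offset-adj s (s≤s z<s) (2+t<n t<k) adj
    ... | inj₁ 2+t≡2 = <⇒≢ 0<t (sym (suc-injective (suc-injective 2+t≡2)))
    ... | inj₂ 1≡3+t rewrite m<n⇒m%n≡m (3+t<n t<k) with 1≡3+t
    ...   | ()
    p : Walk G (Near G (vertex s) (vertex (1 + s))) (vertex (2 + s)) (vertex (2 + k + s))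
    p = record
      { len = k ; at = λ t → vertex (2 + t + s) ; start = refl ; end = refl
      ; step = λ t _ → vertex-adj-suc (2 + t + s) ; avoids = avoids-edge }

  successor-unique : ∀ s {w} → OnCycle G C w → Adj G (vertex (suc s)) w → w ≢ vertex s → vertex (2 + s) ≡ w
  successor-unique s ow sw w≢s with on-cycle ow
  ... | t , refl with vertex-adj (suc s) t sw
  ...   | inj₁ eq = vertex-cong (2 + s) t (sym eq)
  ...   | inj₂ eq = ⊥-elim (w≢s (vertex-cong t s (sym (%-suc-injective s t n eq))))

  predecessor-unique : ∀ s {w} → OnCycle G C w → Adj G (vertex s) w → w ≢ vertex (suc s) → vertex (2 + k + s) ≡ w
  predecessor-unique s ow sw w≢s+1 with on-cycle ow
  ... | t , refl with vertex-adj s t sw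
  ...   | inj₁ eq = ⊥-elim (w≢s+1 (vertex-cong t (suc s) eq))
  ...   | inj₂ eq = vertex-cong (2 + k + s) t (%-suc-injective (2 + k + s) t n (begin
    (n + s) % n  ≡⟨ cong (_% n) (+-comm n s) ⟩
    (s + n) % n  ≡⟨ [m+n]%n≡m%n s n ⟩
    s % n        ≡⟨ eq ⟩
    suc t % n    ∎))
    where open ≡-Reasoning

  arc-from-edge : ∀ s {u v} → OnCycle G C u → OnCycle G C v → Adj G (vertex s) u → Adj G (vertex (suc s)) v →
                  u ≢ vertex (suc s) → v ≢ vertex s → Path G (Near G (vertex s) (vertex (suc s))) v u
  arc-from-edge s ou ov su sv u≢s+1 v≢s
    with successor-unique s ov sv v≢s | predecessor-unique s ou su u≢s+1
  ... | refl | refl = arc s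

  edge-orientation : ∀ {x y} → OnCycle G C x → OnCycle G C y → Adj G x y →
    Σ ℕ (λ s → x ≡ vertex s × y ≡ vertex (suc s)) ⊎ Σ ℕ (λ s → y ≡ vertex s × x ≡ vertex (suc s))
  edge-orientation ox oy xy with on-cycle ox | on-cycle oy
  ... | s , refl | t , refl with vertex-adj s t xy
  ...   | inj₁ eq = inj₁ (s , refl , vertex-cong t (suc s) eq)
  ...   | inj₂ eq = inj₂ (t , refl , vertex-cong s (suc t) eq)

  arc-between : ∀ {x y u v} → OnCycle G C x → OnCycle G C y → OnCycle G C u → OnCycle G C v →
                Adj G x y → Adj G x u → Adj G y v → u ≢ y → v ≢ x → Path G (Near G x y) u v
  arc-between ox oy ou ov xy xu yv u≢y v≢x with edge-orientation ox oy xy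
  ... | inj₁ (s , refl , refl) = reverse (arc-from-edge s ou ov xu yv u≢y v≢x)
  ... | inj₂ (s , refl , refl) = weaken (λ _ → swap) (arc-from-edge s ov ou yv xu v≢x u≢y)

-- Closing a chordless path u … v with the vertices y and x gives the induced
-- cycle u … v y x, with x at index m + 2 adjacent to u at index 0.
module ClosePath {G : Graph} {x y u v : V G} (p : Walk G (Near G x y) u v) (path : IsPath p) (chordless : Chordless p)
    (xy : Adj G x y) (xu : Adj G x u) (yv : Adj G y v) (¬uy : ¬ Adj G u y) (¬xv : ¬ Adj G x v)
    (u≢y : u ≢ y) (v≢x : v ≢ x) where
  open AdjProperties G

  m n : ℕ
  m = len p
  n = 3 + m

  vertex : ℕ → V G
  vertex t with t ≤? m
  ... | yes _ = at p t
  ... | no _ with t ≟ suc m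
  ...   | yes _ = y
  ...   | no _ = x

  vertex-path : ∀ {t} → t ≤ m → vertex t ≡ at p t
  vertex-path {t} t≤ with t ≤? m
  ... | yes _ = refl
  ... | no t≰ = ⊥-elim (t≰ t≤)

  vertex-y : vertex (1 + m) ≡ y
  vertex-y with 1 + m ≤? m
  ... | yes m+1≤m = ⊥-elim (1+n≰n m+1≤m)
  ... | no _ with 1 + m ≟ 1 + m
  ...   | yes _ = refl
  ...   | no ≢ = ⊥-elim (≢ refl)

  vertex-x : vertex (2 + m) ≡ x
  vertex-x with 2 + m ≤? m
  ... | yes m+2≤m = ⊥-elim (1+n≰n (≤-trans (n≤1+n _) m+2≤m))
  ... | no _ with 2 + m ≟ 1 + m
  ...   | yes m+2≡m+1 = ⊥-elim (1+n≢n m+2≡m+1)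
  ...   | no _ = refl

  data Index (t : ℕ) : Set where
    on-path : t ≤ m → Index t
    at-y    : t ≡ 1 + m → Index t
    at-x    : t ≡ 2 + m → Index t

  index : ∀ t → t < n → Index t
  index t t< with m≤n⇒m<n∨m≡n (m<1+n⇒m≤n t<)
  ... | inj₂ eq = at-x eq
  ... | inj₁ t<m+2 with m≤n⇒m<n∨m≡n (m<1+n⇒m≤n t<m+2)
  ...   | inj₂ eq = at-y eq
  ...   | inj₁ t<m+1 = on-path (m<1+n⇒m≤n t<m+1)

  data Inner (t : ℕ) : Set where
    first : t ≡ 0 → Inner t
    last  : t ≡ m → Inner t
    inner : 0 < t → t < m → Inner t

  inner? : ∀ t → t ≤ m → Inner t
  inner? zero _ = first refl
  inner? (suc t) t≤ with m≤n⇒m<n∨m≡n t≤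
  ... | inj₁ t< = inner z<s t<
  ... | inj₂ eq = last eq

  x-adj-only-first : ∀ t → t ≤ m → Adj G x (at p t) → t ≡ 0
  x-adj-only-first t t≤ xw with inner? t t≤
  ... | first eq = eq
  ... | last refl = ⊥-elim (¬xv (subst (Adj G x) (end p) xw))
  ... | inner 0<t t< = ⊥-elim (avoids p t 0<t t< (inj₁ (inj₂ xw)))

  y-adj-only-last : ∀ t → t ≤ m → Adj G y (at p t) → t ≡ m
  y-adj-only-last t t≤ yw with inner? t t≤
  ... | first refl = ⊥-elim (¬uy (Adj-sym (subst (Adj G y) (start p) yw)))
  ... | last eq = eq
  ... | inner 0<t t< = ⊥-elim (avoids p t 0<t t< (inj₂ (inj₂ yw)))

  path≢x : ∀ t → t ≤ m → at p t ≢ x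
  path≢x t t≤ eq with inner? t t≤
  ... | first refl = Adj⇒≢ xu (sym (trans (sym (start p)) eq))
  ... | last refl = v≢x (trans (sym (end p)) eq)
  ... | inner 0<t t< = avoids p t 0<t t< (inj₁ (inj₁ eq))

  path≢y : ∀ t → t ≤ m → at p t ≢ y
  path≢y t t≤ eq with inner? t t≤
  ... | first refl = u≢y (trans (sym (start p)) eq)
  ... | last refl = Adj⇒≢ yv (sym (trans (sym (end p)) eq))
  ... | inner 0<t t< = avoids p t 0<t t< (inj₂ (inj₁ eq))

  Next : ℕ → ℕ → Set
  Next s t = t ≡ suc s % n

  next-path : ∀ {s} → s ≤ m → Next s (suc s)
  next-path s≤ = sym (m<n⇒m%n≡m (s≤s (m≤n⇒m≤1+n (s≤s s≤))))

  next-y : Next (1 + m) (2 + m)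
  next-y = sym (m<n⇒m%n≡m ≤-refl)

  next-x : Next (2 + m) 0
  next-x = sym (n%n≡0 n)

  adj⇒next-from-path : ∀ s t → s ≤ m → t < n → Adj G (vertex s) (vertex t) → Next s t ⊎ Next t s
  adj⇒next-from-path s t s≤ t< st with index t t<
  ... | on-path t≤ with chordless-adj p chordless s≤ t≤ (subst₂ (Adj G) (vertex-path s≤) (vertex-path t≤) st)
  ...   | inj₁ refl = inj₁ (next-path s≤)
  ...   | inj₂ refl = inj₂ (next-path t≤)
  adj⇒next-from-path s t s≤ t< st | at-y refl
    with y-adj-only-last s s≤ (Adj-sym (subst₂ (Adj G) (vertex-path s≤) vertex-y st))
  ...   | refl = inj₁ (next-path s≤)
  adj⇒next-from-path s t s≤ t< st | at-x refl
    with x-adj-only-first s s≤ (Adj-sym (subst₂ (Adj G) (vertex-path s≤) vertex-x st))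
  ...   | refl = inj₂ next-x

  adj⇒next : ∀ s t → s < n → t < n → Adj G (vertex s) (vertex t) → Next s t ⊎ Next t s
  adj⇒next s t s< t< st with index s s< | index t t<
  ... | on-path s≤ | _ = adj⇒next-from-path s t s≤ t< st
  ... | _ | on-path t≤ = swap (adj⇒next-from-path t s t≤ s< (Adj-sym st))
  ... | at-y refl | at-y refl = ⊥-elim (Adj⇒≢ st refl)
  ... | at-y refl | at-x refl = inj₁ next-y
  ... | at-x refl | at-y refl = inj₂ next-y
  ... | at-x refl | at-x refl = ⊥-elim (Adj⇒≢ st refl)

  next⇒adj : ∀ s t → s < n → Next s t → Adj G (vertex s) (vertex t)
  next⇒adj s t s< s→t with index s s<
  ... | on-path s≤ with trans s→t (sym (next-path s≤))
  ...   | refl with m≤n⇒m<n∨m≡n s≤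
  ...     | inj₁ s<m = subst₂ (Adj G) (sym (vertex-path s≤)) (sym (vertex-path s<m)) (step p s s<m)
  ...     | inj₂ refl = subst₂ (Adj G) (sym (trans (vertex-path s≤) (end p))) (sym vertex-y) (Adj-sym yv)
  next⇒adj s t s< s→t | at-y refl with trans s→t (sym next-y)
  ...   | refl = subst₂ (Adj G) (sym vertex-y) (sym vertex-x) (Adj-sym xy)
  next⇒adj s t s< s→t | at-x refl with trans s→t (sym next-x)
  ...   | refl = subst₂ (Adj G) (sym vertex-x) (sym (trans (vertex-path z≤n) (start p))) xu

  vertex-injective : ∀ s t → s < n → t < n → vertex s ≡ vertex t → s ≡ t
  vertex-injective s t s< t< eq with index s s< | index t t<
  ... | on-path s≤ | on-path t≤ = path s t s≤ t≤ (trans (sym (vertex-path s≤)) (trans eq (vertex-path t≤)))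
  ... | on-path s≤ | at-y refl = ⊥-elim (path≢y s s≤ (trans (sym (vertex-path s≤)) (trans eq vertex-y)))
  ... | on-path s≤ | at-x refl = ⊥-elim (path≢x s s≤ (trans (sym (vertex-path s≤)) (trans eq vertex-x)))
  ... | at-y refl | on-path t≤ = ⊥-elim (path≢y t t≤ (trans (sym (vertex-path t≤)) (trans (sym eq) vertex-y)))
  ... | at-x refl | on-path t≤ = ⊥-elim (path≢x t t≤ (trans (sym (vertex-path t≤)) (trans (sym eq) vertex-x)))
  ... | at-y refl | at-y refl = refl
  ... | at-x refl | at-x refl = refl
  ... | at-y refl | at-x refl = ⊥-elim (Adj⇒≢ xy (trans (sym vertex-x) (trans (sym eq) vertex-y)))
  ... | at-x refl | at-y refl = ⊥-elim (Adj⇒≢ xy (trans (sym vertex-x) (trans eq vertex-y)))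

  cycle : InducedCycle G
  cycle = record
    { k = m
    ; f = λ i → vertex (toℕ i)
    ; inj = λ {i} {j} eq → toℕ-injective (vertex-injective (toℕ i) (toℕ j) (toℕ<n i) (toℕ<n j) eq)
    ; adjI = λ i j → adj⇒next (toℕ i) (toℕ j) (toℕ<n i) (toℕ<n j)
                   , λ { (inj₁ i→j) → next⇒adj (toℕ i) (toℕ j) (toℕ<n i) i→j
                       ; (inj₂ j→i) → Adj-sym (next⇒adj (toℕ j) (toℕ i) (toℕ<n j) j→i) } }

  on-cycle : ∀ {t w} → t < n → vertex t ≡ w → OnCycle G cycle w
  on-cycle t< eq = fromℕ< t< , trans (cong vertex (toℕ-fromℕ< t<)) eq

  closed-cycle : Σ (InducedCycle G) λ C → OnCycle G C u × OnCycle G C x × OnCycle G C y × OnCycle G C v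
  closed-cycle = cycle
    , on-cycle z<s (trans (vertex-path z≤n) (start p))
    , on-cycle ≤-refl vertex-x
    , on-cycle (n≤1+n _) vertex-y
    , on-cycle (≤-trans (n≤1+n _) (n≤1+n _)) (trans (vertex-path ≤-refl) (end p))

module _ {G : Graph} {x y : V G} where
  open AdjProperties G

  private
    H = G-B G x y

  B⊆Near : ∀ w → B G x y w → Near G x y w
  B⊆Near w (xw , _) = inj₁ (inj₂ xw)

  Near-G-B⊆Near : ∀ w → Near H (xᴮ G x y) (yᴮ G x y) w → Near G x y (proj₁ w)
  Near-G-B⊆Near w (inj₁ (inj₁ eq)) = inj₁ (inj₁ (cong proj₁ eq))
  Near-G-B⊆Near w (inj₁ (inj₂ xw)) = inj₁ (inj₂ xw)
  Near-G-B⊆Near w (inj₂ (inj₁ eq)) = inj₂ (inj₁ (cong proj₁ eq))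
  Near-G-B⊆Near w (inj₂ (inj₂ yw)) = inj₂ (inj₂ yw)

  Adjacent⊆Near-G-B : ∀ w → Adj G x (proj₁ w) ⊎ Adj G y (proj₁ w) → Near H (xᴮ G x y) (yᴮ G x y) w
  Adjacent⊆Near-G-B w (inj₁ xw) = inj₁ (inj₂ xw)
  Adjacent⊆Near-G-B w (inj₂ yw) = inj₂ (inj₂ yw)

  outside-B⇒P4 : Adj G x y → ∀ {u v} → Adj G x u → Adj G y v → ¬ B G x y u → ¬ B G x y v →
                 u ≢ y → v ≢ x → ¬ Adj G u v → P4WithMiddle G x y u x y v
  outside-B⇒P4 xy xu yv u∉B v∉B u≢y v≢x ¬uv =
    ( Adj-sym xu , xy , yv , (λ uy → u∉B (xu , Adj-sym uy)) , (λ xv → v∉B (xv , yv)) , ¬uv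
    , Adj⇒≢ (Adj-sym xu) , u≢y , (λ { refl → u∉B (xu , yv) }) , Adj⇒≢ xy , (≢-sym v≢x) , Adj⇒≢ yv )
    , inj₁ (refl , refl)

  avoidable⇒arc : Avoidable G x y → Adj G x y → ∀ {u v} → Adj G x u → Adj G y v →
                  ¬ B G x y u → ¬ B G x y v → u ≢ y → v ≢ x → ¬ Adj G u v → Path G (Near G x y) u v
  avoidable⇒arc (inj₁ simplicial) xy {u} {v} xu yv u∉B v∉B u≢y v≢x ¬uv =
    ⊥-elim (simplicial u x y v (outside-B⇒P4 xy xu yv u∉B v∉B u≢y v≢x ¬uv))
  avoidable⇒arc (inj₂ in-cycle) xy {u} {v} xu yv u∉B v∉B u≢y v≢x ¬uv
    with in-cycle u x y v (outside-B⇒P4 xy xu yv u∉B v∉B u≢y v≢x ¬uv)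
  ... | C , ou , ox , oy , ov = OnInducedCycle.arc-between C ox oy ou ov xy xu yv u≢y v≢x

  avoidable⇒protected : Finite G → Adj G x y → Avoidable G x y → Protected H (xᴮ G x y) (yᴮ G x y)
  avoidable⇒protected fin xy avoidable (u , u∉B) (v , v∉B) xu yv
    with finite⇒≟ fin u y | finite⇒≟ fin v x | Adj? u v
  ... | yes refl | _ | _ = toExcludedPath (edge yv)
  ... | no _ | yes refl | _ = toExcludedPath (edge (Adj-sym xu))
  ... | no _ | no _ | yes uv = toExcludedPath (edge uv)
  ... | no u≢y | no v≢x | no ¬uv = toExcludedPath (restrict B⊆Near Near-G-B⊆Near u∉B v∉B u≢v
          (avoidable⇒arc avoidable xy xu yv u∉B v∉B u≢y v≢x ¬uv))
    where
    u≢v : u ≢ v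
    u≢v refl = u∉B (xu , yv)

  cycle-through : Adj G x y → Protected H (xᴮ G x y) (yᴮ G x y) → ∀ {a d} → Adj G x a → Adj G y d →
                  ¬ Adj G a y → ¬ Adj G x d → a ≢ y → d ≢ x →
                  Σ (InducedCycle G) λ C → OnCycle G C a × OnCycle G C x × OnCycle G C y × OnCycle G C d
  cycle-through xy protected {a} {d} xa yd ¬ay ¬xd a≢y d≢x =
    ClosePath.closed-cycle p p-path chordless xy xa yd ¬ay ¬xd a≢y d≢x
    where
    a∉B : ¬ B G x y a
    a∉B (_ , ya) = ¬ay (Adj-sym ya)
    d∉B : ¬ B G x y d
    d∉B (xd , _) = ¬xd xd
    protecting : Walk H (Near H (xᴮ G x y) (yᴮ G x y)) (a , a∉B) (d , d∉B)
    protecting = fromExcludedPath (protected (a , a∉B) (d , d∉B) xa yd)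
    shortened : Σ (Walk G (Near G x y) a d) Chordless
    shortened = shortcut (avoid-closed-neighbourhoods ¬ay ¬xd (unrestrict Adjacent⊆Near-G-B protecting))
    p : Walk G (Near G x y) a d
    p = proj₁ shortened
    chordless : Chordless p
    chordless = proj₂ shortened
    p-path : IsPath p
    p-path = chordless⇒isPath (λ { refl → ¬ay (Adj-sym yd) }) p chordless

  protected⇒avoidable : Adj G x y → Protected H (xᴮ G x y) (yᴮ G x y) → Avoidable G x y
  protected⇒avoidable xy protected = inj₂ in-cycle
    where
    in-cycle : ∀ a b c d → P4WithMiddle G x y a b c d → InInducedCycle G a b c d
    in-cycle a _ _ d ((ab , _ , cd , ¬ac , ¬bd , _ , _ , a≢c , _ , _ , b≢d , _) , inj₁ (refl , refl)) =
      cycle-through xy protected (Adj-sym ab) cd ¬ac ¬bd a≢c (≢-sym b≢d)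
    in-cycle a _ _ d ((ab , _ , cd , ¬ac , ¬bd , _ , _ , a≢c , _ , _ , b≢d , _) , inj₂ (refl , refl))
      with cycle-through xy protected cd (Adj-sym ab) (λ dy → ¬bd (Adj-sym dy)) (λ xa → ¬ac (Adj-sym xa))
             (≢-sym b≢d) a≢c
    ... | C , od , ox , oy , oa = C , oa , oy , ox , od

lemma29 : (G : Graph) → Finite G → (x y : V G) → Adj G x y →
    Avoidable G x y ⇔ Protected (G-B G x y) (xᴮ G x y) (yᴮ G x y)
lemma29 G fin x y xy = mk⇔ (avoidable⇒protected fin xy) (protected⇒avoidable xy)
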